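{- Let $G=(V,E)$ be an undirected graph with positive integer edge weights $w(e)$ and positive integer targets $t(v)$ for $v\in V$. Construct $H$ from $G$ as follows: for each edge $e=\{x,y\}\in E$ with $\gamma=w(e)$, delete the edge and add new vertices $a_e,b_e$, the edge $a_eb_e$, $\gamma$ internally disjoint paths with three edges (two new internal vertices each) from $x$ to $a_e$, and $\gamma$ internally disjoint paths with three edges from $b_e$ to $y$; and for each $v\in V$ add a new pendant vertex adjacent only to $v$. Set the capacity of every new vertex equal to its degree in $H$, and the capacity of each $v\in V$ to $t(v)+1$. Then $G$ has an orientation in which every $v\in V$ has weighted outdegree at most $t(v)$ if and only if $H$ has a capacitated vertex cover of size at most $|V|+\sum_{e\in E}(2w(e)+1)$.
   Context: In an orientation of an edge-weighted graph, the weighted outdegree of $v$ is the sum of weights of the edges oriented out of $v$. Given a graph with vertex capacities $c(v)$, a capacitated vertex cover is a set $S$ of vertices together with an assignment of every edge to an endpoint in $S$ such that each $v\in S$ is assigned at most $c(v)$ edges; its size is $|S|$. -}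

module Defs where

open import Data.Nat using (ℕ; _+_; _≤_)
open import Data.Bool using (Bool; true; false; if_then_else_)
open import Data.Fin using (Fin)
import Data.Fin as Fin
open import Data.List using (List; []; _∷_; _++_; map; concatMap; length; filter; allFin; lookup)
open import Data.Nat.ListAction using (sum)
open import Data.List.Membership.Propositional using (_∈_)
open import Data.List.Relation.Unary.Unique.Propositional using (Unique)
open import Data.Product using (_×_; _,_; proj₁; proj₂; Σ; ∃)
open import Relation.Binary.PropositionalEquality using (_≡_; refl)
open import Relation.Binary.Definitions using (DecidableEquality)
open import Relation.Nullary using (yes; no; ¬_)
open import Relation.Nullary.Decidable using (map′)

-- Finite graphs given by a vertex type with decidable equality and a
-- list of edges (each edge is an unordered pair written as an ordered one).

record FinGraph : Set₁ where
  field
    Vtx   : Set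
    _≟V_  : DecidableEquality Vtx
    edges : List (Vtx × Vtx)

module _ (Γ : FinGraph) where
  open FinGraph Γ

  degree : Vtx → ℕ
  degree v = length (filter (λ e → proj₁ e ≟V v) edges)
           + length (filter (λ e → proj₂ e ≟V v) edges)

  record CapVertexCover (c : Vtx → ℕ) : Set where
    field
      S        : List Vtx
      S-unique : Unique S
      assign   : Fin (length edges) → Bool
    chosen : Fin (length edges) → Vtx
    chosen i = if assign i then proj₁ (lookup edges i) else proj₂ (lookup edges i)
    load : Vtx → ℕ
    load v = length (filter (λ i → chosen i ≟V v) (allFin (length edges)))
    field
      chosen∈S : ∀ i → chosen i ∈ S
      capacity : ∀ v → v ∈ S → load v ≤ c v
    size : ℕ
    size = length S

  HasCapVCOfSizeAtMost : (Vtx → ℕ) → ℕ → Set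
  HasCapVCOfSizeAtMost c k = Σ (CapVertexCover c) λ C → CapVertexCover.size C ≤ k

SimpleGraph : {n m : ℕ} → (Fin m → Fin n × Fin n) → Set
SimpleGraph {n} {m} ends =
  (∀ e → ¬ (proj₁ (ends e) ≡ proj₂ (ends e))) ×
  (∀ e e' → ((proj₁ (ends e) ≡ proj₁ (ends e') × proj₂ (ends e) ≡ proj₂ (ends e'))
             Data.Sum.⊎ (proj₁ (ends e) ≡ proj₂ (ends e') × proj₂ (ends e) ≡ proj₁ (ends e')))
          → e ≡ e')
  where import Data.Sum

Orientation : ℕ → Set
Orientation m = Fin m → Bool

tailOf : {n m : ℕ} → (Fin m → Fin n × Fin n) → Orientation m → Fin m → Fin n
tailOf ends o e = if o e then proj₁ (ends e) else proj₂ (ends e)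

weightedOutdeg : {n m : ℕ} → (Fin m → Fin n × Fin n) → (Fin m → ℕ) →
                 Orientation m → Fin n → ℕ
weightedOutdeg {n} {m} ends w o v =
  sum (map w (filter (λ e → tailOf ends o e Fin.≟ v) (allFin m)))

data HV (n m : ℕ) (w : Fin m → ℕ) : Set where
  orig : Fin n → HV n m w
  pend : Fin n → HV n m w
  aV   : Fin m → HV n m w
  bV   : Fin m → HV n m w
  lp   : (e : Fin m) → Fin (w e) → Fin 2 → HV n m w
    -- j-th internal vertex (j = 0 next to x) of the i-th path x – a_e
  rp   : (e : Fin m) → Fin (w e) → Fin 2 → HV n m w
    -- j-th internal vertex (j = 0 next to b_e) of the i-th path b_e – y

module _ {n m : ℕ} {w : Fin m → ℕ} where
  _≟HV_ : DecidableEquality (HV n m w)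
  orig x ≟HV orig y = map′ (λ { refl → refl }) (λ { refl → refl }) (x Fin.≟ y)
  pend x ≟HV pend y = map′ (λ { refl → refl }) (λ { refl → refl }) (x Fin.≟ y)
  aV x ≟HV aV y = map′ (λ { refl → refl }) (λ { refl → refl }) (x Fin.≟ y)
  bV x ≟HV bV y = map′ (λ { refl → refl }) (λ { refl → refl }) (x Fin.≟ y)
  lp e i j ≟HV lp e' i' j' with e Fin.≟ e'
  ... | no ne = no λ { refl → ne refl }
  ... | yes refl with i Fin.≟ i' | j Fin.≟ j'
  ...   | yes refl | yes refl = yes refl
  ...   | no ni | _ = no λ { refl → ni refl }
  ...   | yes _ | no nj = no λ { refl → nj refl }
  rp e i j ≟HV rp e' i' j' with e Fin.≟ e'
  ... | no ne = no λ { refl → ne refl }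
  ... | yes refl with i Fin.≟ i' | j Fin.≟ j'
  ...   | yes refl | yes refl = yes refl
  ...   | no ni | _ = no λ { refl → ni refl }
  ...   | yes _ | no nj = no λ { refl → nj refl }
  (orig x) ≟HV (pend y) = no λ ()
  (orig x) ≟HV (aV y) = no λ ()
  (orig x) ≟HV (bV y) = no λ ()
  (orig x) ≟HV (lp e' i' j') = no λ ()
  (orig x) ≟HV (rp e' i' j') = no λ ()
  (pend x) ≟HV (orig y) = no λ ()
  (pend x) ≟HV (aV y) = no λ ()
  (pend x) ≟HV (bV y) = no λ ()
  (pend x) ≟HV (lp e' i' j') = no λ ()
  (pend x) ≟HV (rp e' i' j') = no λ ()
  (aV x) ≟HV (orig y) = no λ ()
  (aV x) ≟HV (pend y) = no λ ()
  (aV x) ≟HV (bV y) = no λ ()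
  (aV x) ≟HV (lp e' i' j') = no λ ()
  (aV x) ≟HV (rp e' i' j') = no λ ()
  (bV x) ≟HV (orig y) = no λ ()
  (bV x) ≟HV (pend y) = no λ ()
  (bV x) ≟HV (aV y) = no λ ()
  (bV x) ≟HV (lp e' i' j') = no λ ()
  (bV x) ≟HV (rp e' i' j') = no λ ()
  (lp e i j) ≟HV (orig y) = no λ ()
  (lp e i j) ≟HV (pend y) = no λ ()
  (lp e i j) ≟HV (aV y) = no λ ()
  (lp e i j) ≟HV (bV y) = no λ ()
  (lp e i j) ≟HV (rp e' i' j') = no λ ()
  (rp e i j) ≟HV (orig y) = no λ ()
  (rp e i j) ≟HV (pend y) = no λ ()
  (rp e i j) ≟HV (aV y) = no λ ()
  (rp e i j) ≟HV (bV y) = no λ ()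
  (rp e i j) ≟HV (lp e' i' j') = no λ ()

H-edges : (n m : ℕ) → (Fin m → Fin n × Fin n) → (w : Fin m → ℕ) → List (HV n m w × HV n m w)
H-edges n m ends w =
  concatMap edgeGadget (allFin m) ++ map (λ v → orig v , pend v) (allFin n)
  where
  edgeGadget : Fin m → List (HV n m w × HV n m w)
  edgeGadget e =
    (aV e , bV e) ∷
    concatMap (λ i →
        (orig (proj₁ (ends e)) , lp e i Fin.zero)
      ∷ (lp e i Fin.zero , lp e i (Fin.suc Fin.zero))
      ∷ (lp e i (Fin.suc Fin.zero) , aV e)
      ∷ (bV e , rp e i Fin.zero)
      ∷ (rp e i Fin.zero , rp e i (Fin.suc Fin.zero))
      ∷ (rp e i (Fin.suc Fin.zero) , orig (proj₂ (ends e)))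
      ∷ []) (allFin (w e))

H : (n m : ℕ) → (Fin m → Fin n × Fin n) → (w : Fin m → ℕ) → FinGraph
H n m ends w = record { Vtx = HV n m w ; _≟V_ = _≟HV_ ; edges = H-edges n m ends w }

H-cap : (n m : ℕ) (ends : Fin m → Fin n × Fin n) (w : Fin m → ℕ) →
        (Fin n → ℕ) → HV n m w → ℕ
H-cap n m ends w t (orig v) = t v + 1
H-cap n m ends w t u        = degree (H n m ends w) u

{-# OPTIONS --safe #-}
-- Given an orientation, take V together with, in the gadget of each edge e = xy directed from x to y,
-- the vertex b_e and the path vertices adjacent to a_e and to y (a_e and those adjacent to x and b_e if
-- e is directed from y): |V| + Σ (2w(e) + 1) vertices. Each edge goes to an endpoint in this cover, to the
-- non-original one if both are; so v receives its pendant edge and the w(e) edges joining it to the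
-- gadget of each edge e it is the tail of, at most t(v) + 1 edges; every other vertex has its degree as
-- capacity.
--
-- Conversely, H has a perfect matching with |V| + Σ (2w(e) + 1) edges (v with its pendant, a_e b_e and
-- the middle edge of every path), so a cover of that size contains exactly one end of each of them.
-- Direct e = xy from x iff a_e is not in the cover. Then the w(e) edges joining the tail of e to its
-- gadget have their other end outside the cover, so they must be assigned to the tail, and so must the
-- pendant edge: the capacity t(v) + 1 bounds the weighted outdegree by t(v).
module Submission where

open import Defs
open import Level using (Level)
open import Data.Bool using (Bool; true; false; if_then_else_; not)
open import Data.Fin using (Fin; zero; suc)
import Data.Fin as Fin
open import Data.List using (List; []; _∷_; _++_; map; concatMap; length; filter; allFin; lookup)
open import Data.List.Properties
  using (length-++; length-map; length-tabulate; length-removeAt′; filter-++; filter-accept; filter-reject;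
         map-cong; map-tabulate; tabulate-lookup)
open import Data.List.Membership.Propositional using (_∈_; _∉_)
open import Data.List.Membership.Propositional.Properties
  using (∈-map⁺; ∈-map⁻; ∈-++⁺ˡ; ∈-++⁺ʳ; ∈-concatMap⁺; ∈-concatMap⁻; ∈-filter⁺; ∈-filter⁻; ∈-allFin; ∈-lookup)
open import Data.List.Relation.Binary.Disjoint.Propositional using (Disjoint)
open import Data.List.Relation.Binary.Subset.Propositional using (_⊆_)
open import Data.List.Relation.Unary.All using (All; []; _∷_)
import Data.List.Relation.Unary.All as All
import Data.List.Relation.Unary.All.Properties as All
import Data.List.Relation.Unary.AllPairs as AllPairs
import Data.List.Relation.Unary.AllPairs.Properties as AllPairs
open import Data.List.Relation.Unary.Any using (here; there; index; satisfied; _─_)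
import Data.List.Relation.Unary.Any as Any
open import Data.List.Relation.Unary.Any.Properties using (lookup-index)
open import Data.List.Relation.Unary.Unique.Propositional using (Unique; []; _∷_)
import Data.List.Relation.Unary.Unique.Propositional.Properties as Unique
open import Data.Maybe using (Maybe; just; nothing; _<∣>_)
open import Data.Maybe.Properties using (just-injective)
open import Data.Nat using (ℕ; suc; _+_; _*_; _≤_; z≤n; s≤s)
open import Data.Nat.ListAction using (sum)
open import Data.Nat.Properties
open import Data.Product using (_×_; _,_; proj₁; proj₂; Σ; ∃)
open import Data.Sum using (_⊎_; inj₁; inj₂)
open import Function using (_∘_)
open import Function.Bundles using (_⇔_; mk⇔)
open import Relation.Binary.Definitions using (DecidableEquality)
open import Relation.Binary.PropositionalEquality
open import Relation.Nullary using (¬_; Dec; yes; no; does; contradiction)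
open import Relation.Unary using (Pred; Decidable)

private variable
  ℓ : Level
  A B : Set

∈-─⁺ : {x y : A} {xs : List A} (x∈xs : x ∈ xs) → y ∈ xs → y ≢ x → y ∈ (xs ─ x∈xs)
∈-─⁺ (here refl) (here y≡x)  y≢x = contradiction y≡x y≢x
∈-─⁺ (here refl) (there y∈)  _   = y∈
∈-─⁺ (there x∈)  (here y≡z)  _   = here y≡z
∈-─⁺ (there x∈)  (there y∈)  y≢x = there (∈-─⁺ x∈ y∈ y≢x)

unique⊆⇒length≤ : {xs ys : List A} → Unique xs → xs ⊆ ys → length xs ≤ length ys
unique⊆⇒length≤ {xs = []}     _           _  = z≤n
unique⊆⇒length≤ {xs = x ∷ xs} {ys} (x∉xs ∷ xs!) xs⊆ys = begin
  suc (length xs)          ≤⟨ s≤s (unique⊆⇒length≤ xs! xs⊆ys─x) ⟩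
  suc (length (ys ─ x∈ys)) ≡⟨ sym (length-removeAt′ ys (index x∈ys)) ⟩
  length ys                ∎
  where
  open ≤-Reasoning
  x∈ys = xs⊆ys (here refl)
  xs⊆ys─x : xs ⊆ (ys ─ x∈ys)
  xs⊆ys─x y∈xs = ∈-─⁺ x∈ys (xs⊆ys (there y∈xs)) (λ y≡x → All.lookup x∉xs y∈xs (sym y≡x))

unique⊆map⇒injectiveOn : DecidableEquality A → (f : A → B) {L : List B} {S : List A} →
  Unique L → L ⊆ map f S → length S ≤ length L →
  ∀ {x y} → x ∈ S → y ∈ S → f x ≡ f y → x ≡ y
unique⊆map⇒injectiveOn _≟_ f {L} {S} L! L⊆fS |S|≤|L| {x} {y} x∈S y∈S fx≡fy with x ≟ y
... | yes x≡y = x≡y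
... | no  x≢y = contradiction |S|≤|L| (<⇒≱ (begin-strict
  length L                   ≤⟨ unique⊆⇒length≤ L! L⊆f[S─x] ⟩
  length (map f (S ─ x∈S))   ≡⟨ length-map f (S ─ x∈S) ⟩
  length (S ─ x∈S)           <⟨ n<1+n _ ⟩
  suc (length (S ─ x∈S))     ≡⟨ sym (length-removeAt′ S (index x∈S)) ⟩
  length S                   ∎))
  where
  open ≤-Reasoning
  L⊆f[S─x] : L ⊆ map f (S ─ x∈S)
  L⊆f[S─x] k∈L with ∈-map⁻ f (L⊆fS k∈L)
  ... | s , s∈S , refl with s ≟ x
  ...   | yes refl = subst (_∈ map f (S ─ x∈S)) (sym fx≡fy) (∈-map⁺ f (∈-─⁺ x∈S y∈S (x≢y ∘ sym)))
  ...   | no  s≢x  = ∈-map⁺ f (∈-─⁺ x∈S s∈S s≢x)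

Unique-concatMap : {f : A → List B} (owner : B → Maybe A) →
  (∀ x → All (λ y → owner y ≡ just x) (f x)) → (∀ x → Unique (f x)) →
  {xs : List A} → Unique xs → Unique (concatMap f xs)
Unique-concatMap {f = f} owner owned f! xs! =
  Unique.concat⁺ (All.map⁺ (All.universal f! _)) (AllPairs.map⁺ (AllPairs.map disjoint xs!))
  where
  disjoint : ∀ {x x′} → x ≢ x′ → Disjoint (f x) (f x′)
  disjoint x≢x′ (y∈fx , y∈fx′) =
    x≢x′ (just-injective (trans (sym (All.lookup (owned _) y∈fx)) (All.lookup (owned _) y∈fx′)))

length-concatMap : (f : A → List B) (xs : List A) → length (concatMap f xs) ≡ sum (map (length ∘ f) xs)
length-concatMap f []       = refl
length-concatMap f (x ∷ xs) = trans (length-++ (f x)) (cong (length (f x) +_) (length-concatMap f xs))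

length-map-allFin : ∀ {n} (f : Fin n → A) → length (map f (allFin n)) ≡ n
length-map-allFin {n = n} f = trans (length-map f (allFin n)) (length-tabulate (λ i → i))

sum-map-filter : {P : Pred A ℓ} (P? : Decidable P) (f : A → ℕ) (xs : List A) →
  sum (map f (filter P? xs)) ≡ sum (map (λ x → if does (P? x) then f x else 0) xs)
sum-map-filter P? f []       = refl
sum-map-filter P? f (x ∷ xs) with does (P? x)
... | true  = cong (f x +_) (sum-map-filter P? f xs)
... | false = sum-map-filter P? f xs

sum-map-indicator : (b : Bool) (xs : List A) →
  sum (map (λ _ → if b then 1 else 0) xs) ≡ (if b then length xs else 0)
sum-map-indicator true  []       = refl
sum-map-indicator false []       = refl
sum-map-indicator true  (x ∷ xs) = cong suc (sum-map-indicator true xs)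
sum-map-indicator false (x ∷ xs) = sum-map-indicator false xs

count : {P : Pred A ℓ} → Decidable P → List A → ℕ
count P? xs = length (filter P? xs)

module _ {P : Pred A ℓ} (P? : Decidable P) where

  count-++ : ∀ xs ys → count P? (xs ++ ys) ≡ count P? xs + count P? ys
  count-++ xs ys = trans (cong length (filter-++ P? xs ys)) (length-++ (filter P? xs))

  count-concatMap : (f : B → List A) (xs : List B) →
                    count P? (concatMap f xs) ≡ sum (map (count P? ∘ f) xs)
  count-concatMap f []       = refl
  count-concatMap f (x ∷ xs) = trans (count-++ (f x) _) (cong (count P? (f x) +_) (count-concatMap f xs))

  count-map : (f : B → A) (xs : List B) → count P? (map f xs) ≡ count (P? ∘ f) xs
  count-map f []       = refl
  count-map f (x ∷ xs) with does (P? (f x))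
  ... | true  = cong suc (count-map f xs)
  ... | false = count-map f xs

  count-lookup : (xs : List A) → count (P? ∘ lookup xs) (allFin (length xs)) ≡ count P? xs
  count-lookup xs = trans (sym (count-map (lookup xs) (allFin (length xs))))
    (cong (count P?) (trans (map-tabulate (λ i → i) (lookup xs)) (tabulate-lookup xs)))

count-∷ : {P : Pred A ℓ} (P? : Decidable P) → ∀ x xs → count P? xs ≤ count P? (x ∷ xs)
count-∷ P? x xs with does (P? x)
... | true  = n≤1+n _
... | false = ≤-refl

module _ {P Q R : Pred A ℓ} (P? : Decidable P) (Q? : Decidable Q) (R? : Decidable R) where

  count-≤-+ : (∀ {x} → R x → P x ⊎ Q x) → ∀ xs → count R? xs ≤ count P? xs + count Q? xs
  count-≤-+ R⇒P⊎Q []       = z≤n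
  count-≤-+ R⇒P⊎Q (x ∷ xs) with ih ← count-≤-+ R⇒P⊎Q xs | R? x
  ... | no _  = ≤-trans ih (+-mono-≤ (count-∷ P? x xs) (count-∷ Q? x xs))
  ... | yes r with R⇒P⊎Q r
  ...   | inj₁ p rewrite filter-accept P? {xs = xs} p =
    s≤s (≤-trans ih (+-monoʳ-≤ _ (count-∷ Q? x xs)))
  ...   | inj₂ q rewrite filter-accept Q? {xs = xs} q =
    subst (suc (count R? xs) ≤_) (sym (+-suc (count P? (x ∷ xs)) (count Q? xs)))
          (s≤s (≤-trans ih (+-monoˡ-≤ _ (count-∷ P? x xs))))

count≤1 : {P : Pred A ℓ} (P? : Decidable P) {a : A} {xs : List A} →
          Unique xs → (∀ {x} → P x → x ≡ a) → count P? xs ≤ 1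
count≤1 P? {a} {xs} xs! P⇒≡a =
  unique⊆⇒length≤ {ys = a ∷ []} (Unique.filter⁺ P? xs!)
    (λ x∈ → here (P⇒≡a (proj₂ (∈-filter⁻ P? {xs = xs} x∈))))

owner-concatMap : {f : A → List B} (owner : B → Maybe A) → (∀ x → All (λ y → owner y ≡ just x) (f x)) →
                  ∀ {xs y} → y ∈ concatMap f xs → ∃ λ x → owner y ≡ just x
owner-concatMap {f = f} owner owned {xs} y∈ with satisfied (∈-concatMap⁻ f {xs = xs} y∈)
... | x , y∈fx = x , All.lookup (owned x) y∈fx

1+k+k≡2k+1 : ∀ k → suc (k + k) ≡ 2 * k + 1
1+k+k≡2k+1 k = trans (cong (λ l → suc (k + l)) (sym (+-identityʳ k))) (+-comm 1 (2 * k))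

module _ (Γ : FinGraph) where
  open FinGraph Γ

  load≤degree : (assign : Fin (length edges) → Bool) (v : Vtx) →
    let chosen i = if assign i then proj₁ (lookup edges i) else proj₂ (lookup edges i) in
    count (λ i → chosen i ≟V v) (allFin (length edges)) ≤ degree Γ v
  load≤degree assign v = begin
    count (λ i → chosen i ≟V v) (allFin (length edges))
      ≤⟨ count-≤-+ (λ i → end₁ i ≟V v) (λ i → end₂ i ≟V v) (λ i → chosen i ≟V v) chosen-end
                   (allFin (length edges)) ⟩
    count (λ i → end₁ i ≟V v) (allFin (length edges)) + count (λ i → end₂ i ≟V v) (allFin (length edges))
      ≡⟨ cong₂ _+_ (count-lookup (λ e → proj₁ e ≟V v) edges) (count-lookup (λ e → proj₂ e ≟V v) edges) ⟩
    degree Γ v ∎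
    where
    open ≤-Reasoning
    end₁ end₂ chosen : Fin (length edges) → Vtx
    end₁ i = proj₁ (lookup edges i)
    end₂ i = proj₂ (lookup edges i)
    chosen i = if assign i then end₁ i else end₂ i
    chosen-end : ∀ {i} → chosen i ≡ v → end₁ i ≡ v ⊎ end₂ i ≡ v
    chosen-end {i} with assign i
    ... | true  = inj₁
    ... | false = inj₂

module _ {Γ : FinGraph} {c : FinGraph.Vtx Γ → ℕ} (C : CapVertexCover Γ c) where
  open FinGraph Γ
  open CapVertexCover C

  covers : ∀ {p} → p ∈ edges → proj₁ p ∈ S ⊎ proj₂ p ∈ S
  covers {p} p∈ = subst (λ q → proj₁ q ∈ S ⊎ proj₂ q ∈ S) (sym (lookup-index p∈))
    (endpoint (assign (index p∈)) (lookup edges (index p∈)) (chosen∈S (index p∈)))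
    where
    endpoint : ∀ b q → (if b then proj₁ q else proj₂ q) ∈ S → proj₁ q ∈ S ⊎ proj₂ q ∈ S
    endpoint true  _ = inj₁
    endpoint false _ = inj₂

  OtherEndOutside : Vtx → Vtx × Vtx → Set
  OtherEndOutside v p = (proj₁ p ≡ v × proj₂ p ∉ S) ⊎ (proj₂ p ≡ v × proj₁ p ∉ S)

  ForcedTo : Vtx → Vtx × Vtx → Set
  ForcedTo v p = p ∈ edges × OtherEndOutside v p

  forced⇒∈S : ∀ {v p} → ForcedTo v p → v ∈ S
  forced⇒∈S (p∈ , forced) with covers p∈ | forced
  ... | inj₁ p₁∈S | inj₁ (refl , _)    = p₁∈S
  ... | inj₁ p₁∈S | inj₂ (_ , p₁∉S)    = contradiction p₁∈S p₁∉S
  ... | inj₂ p₂∈S | inj₁ (_ , p₂∉S)    = contradiction p₂∈S p₂∉S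
  ... | inj₂ p₂∈S | inj₂ (refl , _)    = p₂∈S

  forced-≤-load : ∀ {v E} → Unique E → All (ForcedTo v) E → length E ≤ load v
  forced-≤-load {v} {E} E! forced = begin
    length E                                ≤⟨ unique⊆⇒length≤ E! E⊆assigned ⟩
    length (map (lookup edges) assignedToV) ≡⟨ length-map (lookup edges) assignedToV ⟩
    load v                                  ∎
    where
    open ≤-Reasoning
    assignedToV : List (Fin (length edges))
    assignedToV = filter (λ i → chosen i ≟V v) (allFin (length edges))
    endpoint : ∀ b q → (if b then proj₁ q else proj₂ q) ∈ S → OtherEndOutside v q →
               (if b then proj₁ q else proj₂ q) ≡ v
    endpoint true  _ _    (inj₁ (q₁≡v , _))  = q₁≡v
    endpoint true  _ q₁∈S (inj₂ (_ , q₁∉S))  = contradiction q₁∈S q₁∉S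
    endpoint false _ q₂∈S (inj₁ (_ , q₂∉S))  = contradiction q₂∈S q₂∉S
    endpoint false _ _    (inj₂ (q₂≡v , _))  = q₂≡v
    E⊆assigned : E ⊆ map (lookup edges) assignedToV
    E⊆assigned {p} p∈E = subst (_∈ map (lookup edges) assignedToV) (sym (lookup-index p∈edges))
      (∈-map⁺ (lookup edges) (∈-filter⁺ (λ i → chosen i ≟V v) (∈-allFin i)
        (endpoint (assign i) (lookup edges i) (chosen∈S i)
          (subst (OtherEndOutside v) (lookup-index p∈edges) (proj₂ (All.lookup forced p∈E))))))
      where
      p∈edges = proj₁ (All.lookup forced p∈E)
      i = index p∈edges

module Construction (n m : ℕ) (ends : Fin m → Fin n × Fin n) (w : Fin m → ℕ) where

  V : Set
  V = HV n m w

  one : Fin 2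
  one = suc zero

  pathEdges : (e : Fin m) → Fin (w e) → List (V × V)
  pathEdges e i =
    (orig (proj₁ (ends e)) , lp e i zero) ∷ (lp e i zero , lp e i one) ∷ (lp e i one , aV e) ∷
    (bV e , rp e i zero) ∷ (rp e i zero , rp e i one) ∷ (rp e i one , orig (proj₂ (ends e))) ∷ []

  gadget : Fin m → List (V × V)
  gadget e = (aV e , bV e) ∷ concatMap (pathEdges e) (allFin (w e))

  pendantEdges : List (V × V)
  pendantEdges = map (λ v → orig v , pend v) (allFin n)

  -- Definitionally equal to H-edges n m ends w.
  edgesH : List (V × V)
  edgesH = concatMap gadget (allFin m) ++ pendantEdges

  pendant∈H : ∀ v → (orig v , pend v) ∈ edgesH
  pendant∈H v = ∈-++⁺ʳ (concatMap gadget (allFin m)) (∈-map⁺ (λ v → orig v , pend v) (∈-allFin v))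

  gadget⊆H : ∀ {e p} → p ∈ gadget e → p ∈ edgesH
  gadget⊆H {e} p∈ = ∈-++⁺ˡ (∈-concatMap⁺ gadget {xs = allFin m} (Any.map (λ { refl → p∈ }) (∈-allFin e)))

  path⊆H : ∀ {e i p} → p ∈ pathEdges e i → p ∈ edgesH
  path⊆H {e} {i} p∈ =
    gadget⊆H (there (∈-concatMap⁺ (pathEdges e) {xs = allFin (w e)} (Any.map (λ { refl → p∈ }) (∈-allFin i))))

  lpAt rpAt : (e : Fin m) → Fin 2 → Fin (w e) → V
  lpAt e j i = lp e i j
  rpAt e j i = rp e i j

  pathVertices : Fin m → Fin 2 → List V
  pathVertices e j = map (lpAt e j) (allFin (w e)) ++ map (rpAt e j) (allFin (w e))

  side : Fin m → Bool → List V
  side e false = aV e ∷ pathVertices e zero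
  side e true  = bV e ∷ pathVertices e one

  cover : (Fin m → Bool) → List V
  cover β = map orig (allFin n) ++ concatMap (λ e → side e (β e)) (allFin m)

  N : ℕ
  N = n + sum (map (λ e → 2 * w e + 1) (allFin m))

  length-pathVertices : ∀ e j → length (pathVertices e j) ≡ w e + w e
  length-pathVertices e j = trans (length-++ (map (lpAt e j) (allFin (w e))))
    (cong₂ _+_ (length-map-allFin (lpAt e j)) (length-map-allFin (rpAt e j)))

  length-side : ∀ e b → length (side e b) ≡ 2 * w e + 1
  length-side e false = trans (cong suc (length-pathVertices e zero)) (1+k+k≡2k+1 (w e))
  length-side e true  = trans (cong suc (length-pathVertices e one)) (1+k+k≡2k+1 (w e))

  length-cover : ∀ β → length (cover β) ≡ N
  length-cover β = begin
    length (cover β)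
      ≡⟨ length-++ (map orig (allFin n)) ⟩
    length (map orig (allFin n)) + length (concatMap (λ e → side e (β e)) (allFin m))
      ≡⟨ cong₂ _+_ (length-map-allFin orig) (length-concatMap (λ e → side e (β e)) (allFin m)) ⟩
    n + sum (map (λ e → length (side e (β e))) (allFin m))
      ≡⟨ cong (λ xs → n + sum xs) (map-cong (λ e → length-side e (β e)) (allFin m)) ⟩
    N ∎
    where open ≡-Reasoning

  gadgetOf : V → Maybe (Fin m)
  gadgetOf (orig _)   = nothing
  gadgetOf (pend _)   = nothing
  gadgetOf (aV e)     = just e
  gadgetOf (bV e)     = just e
  gadgetOf (lp e _ _) = just e
  gadgetOf (rp e _ _) = just e

  All-pathVertices : ∀ {P : V → Set} e j → (∀ i → P (lp e i j)) → (∀ i → P (rp e i j)) →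
                     All P (pathVertices e j)
  All-pathVertices e j Plp Prp =
    All.++⁺ (All.map⁺ (All.universal Plp (allFin (w e)))) (All.map⁺ (All.universal Prp (allFin (w e))))

  pathVertices-owned : ∀ e j → All (λ u → gadgetOf u ≡ just e) (pathVertices e j)
  pathVertices-owned e j = All-pathVertices e j (λ _ → refl) (λ _ → refl)

  side-owned : ∀ e b → All (λ u → gadgetOf u ≡ just e) (side e b)
  side-owned e false = refl ∷ pathVertices-owned e zero
  side-owned e true  = refl ∷ pathVertices-owned e one

  pathVertices-unique : ∀ e j → Unique (pathVertices e j)
  pathVertices-unique e j = Unique.++⁺ (Unique.map⁺ (λ { refl → refl }) (Unique.allFin⁺ (w e)))
    (Unique.map⁺ (λ { refl → refl }) (Unique.allFin⁺ (w e))) lp≢rp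
    where
    lp≢rp : ∀ {u} → ¬ (u ∈ map (lpAt e j) (allFin (w e)) × u ∈ map (rpAt e j) (allFin (w e)))
    lp≢rp (u∈lps , u∈rps) with ∈-map⁻ (lpAt e j) u∈lps | ∈-map⁻ (rpAt e j) u∈rps
    ... | _ , _ , refl | _ , _ , ()

  side-unique : ∀ e b → Unique (side e b)
  side-unique e false = All-pathVertices e zero (λ _ ()) (λ _ ())
                        ∷ pathVertices-unique e zero
  side-unique e true  = All-pathVertices e one (λ _ ()) (λ _ ())
                        ∷ pathVertices-unique e one

  cover-unique : ∀ β → Unique (cover β)
  cover-unique β = Unique.++⁺ (Unique.map⁺ (λ { refl → refl }) (Unique.allFin⁺ n))
    (Unique-concatMap gadgetOf (λ e → side-owned e (β e)) (λ e → side-unique e (β e)) (Unique.allFin⁺ m))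
    orig∉sides
    where
    orig∉sides : ∀ {u} → ¬ (u ∈ map orig (allFin n) × u ∈ concatMap (λ e → side e (β e)) (allFin m))
    orig∉sides (u∈origs , u∈sides) with ∈-map⁻ orig u∈origs
    ... | _ , _ , refl with owner-concatMap gadgetOf (λ e → side-owned e (β e)) {xs = allFin m} u∈sides
    ...   | _ , ()

  orig∈cover : ∀ {β} v → orig v ∈ cover β
  orig∈cover v = ∈-++⁺ˡ (∈-map⁺ orig (∈-allFin v))

  side⊆cover : ∀ {β e b u} → β e ≡ b → u ∈ side e b → u ∈ cover β
  side⊆cover {β} {e} refl u∈ = ∈-++⁺ʳ (map orig (allFin n))
    (∈-concatMap⁺ (λ e → side e (β e)) {xs = allFin m} (Any.map (λ { refl → u∈ }) (∈-allFin e)))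

  lp∈side : ∀ {e} b i → lp e i (if b then one else zero) ∈ side e b
  lp∈side {e} false i = there (∈-++⁺ˡ (∈-map⁺ (lpAt e zero) (∈-allFin i)))
  lp∈side {e} true  i = there (∈-++⁺ˡ (∈-map⁺ (lpAt e one) (∈-allFin i)))

  rp∈side : ∀ {e} b i → rp e i (if b then one else zero) ∈ side e b
  rp∈side {e} false i = there (∈-++⁺ʳ (map (lpAt e zero) (allFin (w e))) (∈-map⁺ (rpAt e zero) (∈-allFin i)))
  rp∈side {e} true  i = there (∈-++⁺ʳ (map (lpAt e one) (allFin (w e))) (∈-map⁺ (rpAt e one) (∈-allFin i)))

  -- The edges matchingEdge u form a perfect matching of H; reps contains one end of each of its N edges.
  matchingEdge : V → V × V
  matchingEdge (orig v)   = orig v , pend v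
  matchingEdge (pend v)   = orig v , pend v
  matchingEdge (aV e)     = aV e , bV e
  matchingEdge (bV e)     = aV e , bV e
  matchingEdge (lp e i _) = lp e i zero , lp e i one
  matchingEdge (rp e i _) = rp e i zero , rp e i one

  rep : V → V
  rep u = proj₁ (matchingEdge u)

  reps : List V
  reps = cover (λ _ → false)

  rep-reps : All (λ u → rep u ≡ u) reps
  rep-reps = All.++⁺ (All.map⁺ (All.universal (λ _ → refl) (allFin n))) (All.concat⁺ (All.map⁺ (All.universal
    (λ e → refl ∷ All-pathVertices e zero (λ _ → refl) (λ _ → refl)) (allFin m))))

  matchingEdge∈H : ∀ u → matchingEdge u ∈ edgesH
  matchingEdge∈H (orig v)   = pendant∈H v
  matchingEdge∈H (pend v)   = pendant∈H v
  matchingEdge∈H (aV e)     = gadget⊆H {e} (here refl)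
  matchingEdge∈H (bV e)     = gadget⊆H {e} (here refl)
  matchingEdge∈H (lp e i _) = path⊆H {e} {i} (there (here refl))
  matchingEdge∈H (rp e i _) = path⊆H {e} {i} (there (there (there (there (here refl)))))

  matchingEdge-rep : ∀ u → rep (proj₁ (matchingEdge u)) ≡ rep u × rep (proj₂ (matchingEdge u)) ≡ rep u
  matchingEdge-rep (orig _)   = refl , refl
  matchingEdge-rep (pend _)   = refl , refl
  matchingEdge-rep (aV _)     = refl , refl
  matchingEdge-rep (bV _)     = refl , refl
  matchingEdge-rep (lp _ _ _) = refl , refl
  matchingEdge-rep (rp _ _ _) = refl , refl

module Forward (n m : ℕ) (ends : Fin m → Fin n × Fin n) (w : Fin m → ℕ) where
  open Construction n m ends w

  assignEnd : Orientation m → V × V → Bool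
  assignEnd o (aV e , _)           = not (o e)
  assignEnd o (orig _ , lp e _ _)  = o e
  assignEnd o (lp e _ zero , _)    = not (o e)
  assignEnd o (lp e _ (suc _) , _) = o e
  assignEnd o (bV e , _)           = o e
  assignEnd o (rp e _ zero , _)    = not (o e)
  assignEnd o (rp e _ (suc _) , _) = o e
  assignEnd o _                    = true

  chosenEnd : Orientation m → V × V → V
  chosenEnd o p = if assignEnd o p then proj₁ p else proj₂ p

  -- On the paths of e the assignment only depends on o e, so it agrees with the one for the constant
  -- orientation λ _ → o e; case analysis on o e then makes it compute.
  pathChoices : Bool → (e : Fin m) → Fin (w e) → List V
  pathChoices b e i = map (chosenEnd (λ _ → b)) (pathEdges e i)

  pathChoices⊆cover : ∀ o e i → All (_∈ cover o) (pathChoices (o e) e i)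
  pathChoices⊆cover o e i with o e in eq
  ... | true  = orig∈cover _ ∷ side⊆cover eq (lp∈side true i) ∷ side⊆cover eq (lp∈side true i)
              ∷ side⊆cover eq (here refl) ∷ side⊆cover eq (rp∈side true i) ∷ side⊆cover eq (rp∈side true i) ∷ []
  ... | false = side⊆cover eq (lp∈side false i) ∷ side⊆cover eq (lp∈side false i) ∷ side⊆cover eq (here refl)
              ∷ side⊆cover eq (rp∈side false i) ∷ side⊆cover eq (rp∈side false i) ∷ orig∈cover _ ∷ []

  middleChoice∈cover : ∀ o e → chosenEnd o (aV e , bV e) ∈ cover o
  middleChoice∈cover o e with o e in eq
  ... | true  = side⊆cover eq (here refl)
  ... | false = side⊆cover eq (here refl)

  chosenEnd∈cover : ∀ o → All (λ p → chosenEnd o p ∈ cover o) edgesH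
  chosenEnd∈cover o = All.++⁺ (All.concat⁺ (All.map⁺ (All.universal gadgetChoices (allFin m))))
                              (All.map⁺ (All.universal orig∈cover (allFin n)))
    where
    gadgetChoices : ∀ e → All (λ p → chosenEnd o p ∈ cover o) (gadget e)
    gadgetChoices e = middleChoice∈cover o e ∷ All.concat⁺ (All.map⁺ (All.universal
      (λ i → All.map⁻ {f = chosenEnd o} (pathChoices⊆cover o e i)) (allFin (w e))))

  pathChoices-load : ∀ v b e i → count (_≟HV orig v) (pathChoices b e i)
                                  ≡ (if does ((if b then proj₁ (ends e) else proj₂ (ends e)) Fin.≟ v) then 1 else 0)
  pathChoices-load v true  e i with proj₁ (ends e) Fin.≟ v
  ... | yes _ = refl
  ... | no  _ = refl
  pathChoices-load v false e i with proj₂ (ends e) Fin.≟ v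
  ... | yes _ = refl
  ... | no  _ = refl

  module _ (o : Orientation m) (v : Fin n) where

    chosen≟v : ∀ p → Dec (chosenEnd o p ≡ orig v)
    chosen≟v p = chosenEnd o p ≟HV orig v

    path-load : ∀ e i → count chosen≟v (pathEdges e i) ≡ (if does (tailOf ends o e Fin.≟ v) then 1 else 0)
    path-load e i = trans (sym (count-map (_≟HV orig v) (chosenEnd o) (pathEdges e i)))
                          (pathChoices-load v (o e) e i)

    gadget-load : ∀ e → count chosen≟v (gadget e) ≡ (if does (tailOf ends o e Fin.≟ v) then w e else 0)
    gadget-load e = begin
      count chosen≟v ((aV e , bV e) ∷ paths)
        ≡⟨ cong length (filter-reject chosen≟v {x = aV e , bV e} {xs = paths} (middle≢orig (o e))) ⟩
      count chosen≟v paths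
        ≡⟨ count-concatMap chosen≟v (pathEdges e) (allFin (w e)) ⟩
      sum (map (count chosen≟v ∘ pathEdges e) (allFin (w e)))
        ≡⟨ cong sum (map-cong (path-load e) (allFin (w e))) ⟩
      sum (map (λ _ → if isTail then 1 else 0) (allFin (w e)))
        ≡⟨ sum-map-indicator isTail (allFin (w e)) ⟩
      (if isTail then length (allFin (w e)) else 0)
        ≡⟨ cong (λ k → if isTail then k else 0) (length-tabulate (λ i → i)) ⟩
      (if isTail then w e else 0) ∎
      where
      open ≡-Reasoning
      paths = concatMap (pathEdges e) (allFin (w e))
      isTail = does (tailOf ends o e Fin.≟ v)
      middle≢orig : ∀ b → (if not b then aV e else bV e) ≢ orig v
      middle≢orig true  ()
      middle≢orig false ()

    load-orig : count chosen≟v edgesH ≤ weightedOutdeg ends w o v + 1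
    load-orig = begin
      count chosen≟v edgesH
        ≡⟨ count-++ chosen≟v (concatMap gadget (allFin m)) pendantEdges ⟩
      count chosen≟v (concatMap gadget (allFin m)) + count chosen≟v pendantEdges
        ≡⟨ cong (_+ count chosen≟v pendantEdges) gadgets-load ⟩
      weightedOutdeg ends w o v + count chosen≟v pendantEdges
        ≤⟨ +-monoʳ-≤ (weightedOutdeg ends w o v) pendants-load ⟩
      weightedOutdeg ends w o v + 1 ∎
      where
      open ≤-Reasoning
      gadgets-load : count chosen≟v (concatMap gadget (allFin m)) ≡ weightedOutdeg ends w o v
      gadgets-load = trans (count-concatMap chosen≟v gadget (allFin m))
        (trans (cong sum (map-cong gadget-load (allFin m)))
               (sym (sum-map-filter (λ e → tailOf ends o e Fin.≟ v) w (allFin m))))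
      pendants-load : count chosen≟v pendantEdges ≤ 1
      pendants-load = ≤-trans (≤-reflexive (count-map chosen≟v (λ u → orig u , pend u) (allFin n)))
                              (count≤1 _ (Unique.allFin⁺ n) (λ { refl → refl }))

  fromOrientation : (t : Fin n → ℕ) (o : Orientation m) → (∀ v → weightedOutdeg ends w o v ≤ t v) →
                    HasCapVCOfSizeAtMost (H n m ends w) (H-cap n m ends w t) N
  fromOrientation t o outdeg≤t = C , ≤-reflexive (length-cover o)
    where
    C : CapVertexCover (H n m ends w) (H-cap n m ends w t)
    C = record
      { S        = cover o
      ; S-unique = cover-unique o
      ; assign   = assign
      ; chosen∈S = λ i → All.lookup (chosenEnd∈cover o) (∈-lookup i)
      ; capacity = capacity
      }
      where
      assign : Fin (length edgesH) → Bool
      assign i = assignEnd o (lookup edgesH i)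
      capacity : ∀ u → u ∈ cover o →
                 count (λ i → chosenEnd o (lookup edgesH i) ≟HV u) (allFin (length edgesH)) ≤ H-cap n m ends w t u
      capacity (orig v)   _ = begin
        count (chosen≟v o v ∘ lookup edgesH) (allFin (length edgesH)) ≡⟨ count-lookup (chosen≟v o v) edgesH ⟩
        count (chosen≟v o v) edgesH                                   ≤⟨ load-orig o v ⟩
        weightedOutdeg ends w o v + 1                                 ≤⟨ +-monoˡ-≤ 1 (outdeg≤t v) ⟩
        t v + 1                                                       ∎
        where open ≤-Reasoning
      capacity u@(pend _)   _ = load≤degree (H n m ends w) assign u
      capacity u@(aV _)     _ = load≤degree (H n m ends w) assign u
      capacity u@(bV _)     _ = load≤degree (H n m ends w) assign u
      capacity u@(lp _ _ _) _ = load≤degree (H n m ends w) assign u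
      capacity u@(rp _ _ _) _ = load≤degree (H n m ends w) assign u

module Backward (n m : ℕ) (ends : Fin m → Fin n × Fin n) (w : Fin m → ℕ) where
  open Construction n m ends w

  edgeGadgetOf : V × V → Maybe (Fin m)
  edgeGadgetOf (u , u′) = gadgetOf u <∣> gadgetOf u′

  firstEdge lastEdge : (e : Fin m) → Fin (w e) → V × V
  firstEdge e i = orig (proj₁ (ends e)) , lp e i zero
  lastEdge  e i = rp e i one , orig (proj₂ (ends e))

  tailEdges : Fin m → Bool → List (V × V)
  tailEdges e true  = map (firstEdge e) (allFin (w e))
  tailEdges e false = map (lastEdge e) (allFin (w e))

  tailEdges-owned : ∀ e b → All (λ p → edgeGadgetOf p ≡ just e) (tailEdges e b)
  tailEdges-owned e true  = All.map⁺ (All.universal (λ _ → refl) (allFin (w e)))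
  tailEdges-owned e false = All.map⁺ (All.universal (λ _ → refl) (allFin (w e)))

  tailEdges-unique : ∀ e b → Unique (tailEdges e b)
  tailEdges-unique e true  = Unique.map⁺ (λ { refl → refl }) (Unique.allFin⁺ (w e))
  tailEdges-unique e false = Unique.map⁺ (λ { refl → refl }) (Unique.allFin⁺ (w e))

  length-tailEdges : ∀ e b → length (tailEdges e b) ≡ w e
  length-tailEdges e true  = length-map-allFin (firstEdge e)
  length-tailEdges e false = length-map-allFin (lastEdge e)

  module _ (t : Fin n → ℕ) (C : CapVertexCover (H n m ends w) (H-cap n m ends w t))
           (size≤N : CapVertexCover.size C ≤ N) where
    open CapVertexCover C
    open import Data.List.Membership.DecPropositional (_≟HV_ {n} {m} {w}) using (_∈?_)

    reps⊆rep[S] : reps ⊆ map rep S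
    reps⊆rep[S] {k} k∈reps with covers C (matchingEdge∈H k)
    ... | inj₁ u∈S = subst (_∈ map rep S) (trans (proj₁ (matchingEdge-rep k)) (All.lookup rep-reps k∈reps))
                           (∈-map⁺ rep u∈S)
    ... | inj₂ u∈S = subst (_∈ map rep S) (trans (proj₂ (matchingEdge-rep k)) (All.lookup rep-reps k∈reps))
                           (∈-map⁺ rep u∈S)

    rep-injectiveOn-S : ∀ {u u′} → u ∈ S → u′ ∈ S → rep u ≡ rep u′ → u ≡ u′
    rep-injectiveOn-S = unique⊆map⇒injectiveOn _≟HV_ rep (cover-unique (λ _ → false)) reps⊆rep[S]
      (subst (length S ≤_) (sym (length-cover (λ _ → false))) size≤N)

    not-both-in-S : ∀ {u u′} → rep u ≡ rep u′ → u ≢ u′ → u ∈ S → u′ ∉ S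
    not-both-in-S rep≡ u≢u′ u∈S u′∈S = u≢u′ (rep-injectiveOn-S u∈S u′∈S rep≡)

    o : Orientation m
    o e = not (does (aV e ∈? S))

    aV∉S : ∀ {e} → o e ≡ true → aV e ∉ S
    aV∉S {e} with aV e ∈? S
    ... | yes _   = λ ()
    ... | no  aV∉ = λ _ → aV∉

    aV∈S : ∀ {e} → o e ≡ false → aV e ∈ S
    aV∈S {e} with aV e ∈? S
    ... | yes aV∈ = λ _ → aV∈
    ... | no  _   = λ ()

    lp₀∉S : ∀ {e} i → o e ≡ true → lp e i zero ∉ S
    lp₀∉S {e} i oe≡true lp₀∈S with covers C (path⊆H {e} {i} (there (there (here refl))))
    ... | inj₁ lp₁∈S = not-both-in-S refl (λ ()) lp₀∈S lp₁∈S
    ... | inj₂ aV∈ = aV∉S oe≡true aV∈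

    rp₁∉S : ∀ {e} i → o e ≡ false → rp e i one ∉ S
    rp₁∉S {e} i oe≡false rp₁∈S with covers C (path⊆H {e} {i} (there (there (there (here refl)))))
    ... | inj₁ bV∈S  = not-both-in-S refl (λ ()) (aV∈S oe≡false) bV∈S
    ... | inj₂ rp₀∈S = not-both-in-S refl (λ ()) rp₀∈S rp₁∈S

    tailEdges-forced : ∀ e b → o e ≡ b →
                       All (ForcedTo C (orig (if b then proj₁ (ends e) else proj₂ (ends e)))) (tailEdges e b)
    tailEdges-forced e true  oe≡b = All.map⁺ (All.universal
      (λ i → path⊆H {e} {i} (here refl) , inj₁ (refl , lp₀∉S i oe≡b)) (allFin (w e)))
    tailEdges-forced e false oe≡b = All.map⁺ (All.universal
      (λ i → path⊆H {e} {i} (there (there (there (there (there (here refl)))))) , inj₂ (refl , rp₁∉S i oe≡b))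
      (allFin (w e)))

    module _ (v : Fin n) where

      outGadgets : List (Fin m)
      outGadgets = filter (λ e → tailOf ends o e Fin.≟ v) (allFin m)

      outEdges : List (V × V)
      outEdges = concatMap (λ e → tailEdges e (o e)) outGadgets

      outEdges-unique : Unique outEdges
      outEdges-unique =
        Unique-concatMap edgeGadgetOf (λ e → tailEdges-owned e (o e)) (λ e → tailEdges-unique e (o e))
          (Unique.filter⁺ (λ e → tailOf ends o e Fin.≟ v) (Unique.allFin⁺ m))

      outEdges-forced : All (ForcedTo C (orig v)) outEdges
      outEdges-forced = All.concat⁺ (All.map⁺ (All.map
        (λ {e} tail≡v → subst (λ u → All (ForcedTo C (orig u)) (tailEdges e (o e))) tail≡v
                              (tailEdges-forced e (o e) refl))
        (All.all-filter (λ e → tailOf ends o e Fin.≟ v) (allFin m))))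

      pendant∉outEdges : (orig v , pend v) ∉ outEdges
      pendant∉outEdges p∈ with owner-concatMap edgeGadgetOf (λ e → tailEdges-owned e (o e)) {xs = outGadgets} p∈
      ... | _ , ()

      length-outEdges : length outEdges ≡ weightedOutdeg ends w o v
      length-outEdges = trans (length-concatMap (λ e → tailEdges e (o e)) outGadgets)
        (cong sum (map-cong (λ e → length-tailEdges e (o e)) outGadgets))

      -- If v has an out-edge then v ∈ S, so its pendant is not in S and adds one more forced edge.
      forced-≤-target : (E : List (V × V)) → Unique E → All (ForcedTo C (orig v)) E → (orig v , pend v) ∉ E →
                        length E ≤ t v
      forced-≤-target []          _  _      _         = z≤n
      forced-≤-target E@(_ ∷ _)  E! forced pendant∉E = ≤-pred (begin
        suc (length E)  ≤⟨ forced-≤-load C (All.¬Any⇒All¬ E pendant∉E ∷ E!) (pendant-forced ∷ forced) ⟩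
        load (orig v)   ≤⟨ capacity (orig v) v∈S ⟩
        t v + 1         ≡⟨ +-comm (t v) 1 ⟩
        suc (t v)       ∎)
        where
        open ≤-Reasoning
        v∈S = forced⇒∈S C (All.head forced)
        pendant-forced : ForcedTo C (orig v) (orig v , pend v)
        pendant-forced = pendant∈H v , inj₁ (refl , not-both-in-S refl (λ ()) v∈S)

      outdeg≤t : weightedOutdeg ends w o v ≤ t v
      outdeg≤t = subst (_≤ t v) length-outEdges
        (forced-≤-target outEdges outEdges-unique outEdges-forced pendant∉outEdges)

    fromCover : Σ (Orientation m) (λ o → ∀ v → weightedOutdeg ends w o v ≤ t v)
    fromCover = o , outdeg≤t

mainTheorem14 :
    (n m : ℕ) (ends : Fin m → Fin n × Fin n) (w : Fin m → ℕ) (t : Fin n → ℕ) →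
    SimpleGraph ends →
    (∀ e → 1 ≤ w e) →
    (∀ v → 1 ≤ t v) →
    (Σ (Orientation m) (λ o → ∀ v → weightedOutdeg ends w o v ≤ t v))
      ⇔ HasCapVCOfSizeAtMost (H n m ends w) (H-cap n m ends w t)
          (n + sum (map (λ e → 2 * w e + 1) (allFin m)))
mainTheorem14 n m ends w t _ _ _ =
  mk⇔ (λ (o , outdeg≤t) → Forward.fromOrientation n m ends w t o outdeg≤t)
      (λ (C , size≤N) → Backward.fromCover n m ends w t C size≤N)
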